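{- Let $m$ be a positive integer and $k$ a nonnegative integer. There is a bijection between the set $\mathcal{Q}'(m,k)$ and the set $\mathcal{SD}(2m,2k+1)$.
   Context: For a positive integer $K$ and real $s$, a free ballot $(s,K)$-path of height $n$ is a lattice path from $(0,0)$ to $(s,n)$ with up steps $(K/2,1)$, down steps $(K/2,-1)$ and horizontal steps $(\ell,0)$ ($\ell$ an integer, $1\le\ell<K$), allowed to go below the $x$-axis. $\mathcal{FB}'_n(s,K)$ is the set of such paths whose first step is horizontal or down. $\mathcal{Q}'(m,k)=\bigl(\bigcup_{i=0}^{k-1}\mathcal{FB}'_0(m-i,2k+1)\bigr)\cup\mathcal{FB}'_{ -1}(m+\tfrac12,2k+1)$. An $(s,K)$-Dyck path is a free ballot $(s,K)$-path of height $0$ never going below the $x$-axis; it is symmetric if its reflection about the line $x=s/2$ is itself. $\mathcal{SD}(s,K)$ is the set of symmetric $(s,K)$-Dyck paths. -}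

module Defs where

open import Data.Nat as ℕ using (ℕ; zero; suc)
open import Data.Integer as ℤ using (ℤ; +_; -[1+_]; 0ℤ)
open import Data.List using (List; []; _∷_; reverse; map)
open import Data.Product using (Σ; _×_; ∃-syntax)
open import Data.Sum using (_⊎_)
open import Data.Unit using (⊤)
open import Data.Empty using (⊥)
open import Relation.Binary.PropositionalEquality using (_≡_)

-- Steps of an (s,K)-path.  x-coordinates are DOUBLED throughout, so that
-- the half-integer widths K/2 become integers:
--   up   = (K/2, 1)   has doubled width K
--   down = (K/2,-1)   has doubled width K
--   hor ℓ = (ℓ,0), 1 ≤ ℓ < K, has doubled width 2ℓ
data Step (K : ℕ) : Set where
  up   : Step K
  down : Step K
  hor  : (ℓ : ℕ) → 1 ℕ.≤ ℓ → ℓ ℕ.< K → Step K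

width2 : {K : ℕ} → Step K → ℕ
width2 {K} up = K
width2 {K} down = K
width2 (hor ℓ _ _) = 2 ℕ.* ℓ

rise : {K : ℕ} → Step K → ℤ
rise up = + 1
rise down = -[1+ 0 ]
rise (hor _ _ _) = 0ℤ

totalWidth2 : {K : ℕ} → List (Step K) → ℤ
totalWidth2 [] = 0ℤ
totalWidth2 (s ∷ p) = + width2 s ℤ.+ totalWidth2 p

totalRise : {K : ℕ} → List (Step K) → ℤ
totalRise [] = 0ℤ
totalRise (s ∷ p) = rise s ℤ.+ totalRise p

-- p is a free ballot (s,K)-path of height n, where w = 2s
IsFreeBallot : (K : ℕ) → (w : ℤ) → (n : ℤ) → List (Step K) → Set
IsFreeBallot K w n p = (totalWidth2 p ≡ w) × (totalRise p ≡ n)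

-- "first step is horizontal or down" (read as: the path does not start
-- with an up step; the empty path qualifies)
FirstNotUp : {K : ℕ} → List (Step K) → Set
FirstNotUp [] = ⊤
FirstNotUp (up ∷ _) = ⊥
FirstNotUp (down ∷ _) = ⊤
FirstNotUp (hor _ _ _ ∷ _) = ⊤

IsFB' : (K : ℕ) → (w : ℤ) → (n : ℤ) → List (Step K) → Set
IsFB' K w n p = IsFreeBallot K w n p × FirstNotUp p

-- membership in Q'(m,k) = (⋃_{i=0}^{k-1} FB'_0(m-i,2k+1)) ∪ FB'_{-1}(m+1/2,2k+1)
IsQ' : (m k : ℕ) → List (Step (2 ℕ.* k ℕ.+ 1)) → Set
IsQ' m k p =
  (∃[ i ] ((i ℕ.< k) × IsFB' (2 ℕ.* k ℕ.+ 1) (+ (2 ℕ.* m) ℤ.- + (2 ℕ.* i)) 0ℤ p))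
  ⊎ IsFB' (2 ℕ.* k ℕ.+ 1) (+ (2 ℕ.* m ℕ.+ 1)) -[1+ 0 ] p

Q' : (m k : ℕ) → Set
Q' m k = Σ (List (Step (2 ℕ.* k ℕ.+ 1))) (IsQ' m k)

NeverBelowFrom : {K : ℕ} → ℤ → List (Step K) → Set
NeverBelowFrom h [] = ⊤
NeverBelowFrom h (s ∷ p) = (0ℤ ℤ.≤ h ℤ.+ rise s) × NeverBelowFrom (h ℤ.+ rise s) p

-- reflection of a step / path about the vertical line x = s/2
reflectStep : {K : ℕ} → Step K → Step K
reflectStep up = down
reflectStep down = up
reflectStep (hor ℓ a b) = hor ℓ a b

reflect : {K : ℕ} → List (Step K) → List (Step K)
reflect p = reverse (map reflectStep p)

IsDyck : (K : ℕ) → (w : ℤ) → List (Step K) → Set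
IsDyck K w p = IsFreeBallot K w 0ℤ p × NeverBelowFrom 0ℤ p

IsSymDyck : (K : ℕ) → (w : ℤ) → List (Step K) → Set
IsSymDyck K w p = IsDyck K w p × (reflect p ≡ p)

-- SD(s,K), with w = 2s
SD : (K : ℕ) → (w : ℤ) → Set
SD K w = Σ (List (Step K)) (IsSymDyck K w)

module Submission where

open import Defs
open import Data.Nat using (ℕ; _≤_; _*_; _+_)
open import Data.Integer using (+_)
open import Function.Bundles using (_⤖_)

open import Data.Nat using (zero; suc; _<_; _∸_; z≤n; s≤s; _/_; _%_)
open import Data.Nat.DivMod using (m≡m%n+[m/n]*n; m%n<n; [m+kn]%n≡m%n; m*n%n≡0; m/n≤m; m<n⇒m/n≡0; m*n/n≡m; +-distrib-/-∣ʳ)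
open import Data.Nat.Divisibility using (divides)
import Data.Nat.Properties as ℕP
open import Data.Integer as ℤ using (ℤ; -[1+_]; 0ℤ)
import Data.Integer.Properties as ℤP
import Data.Integer.Tactic.RingSolver as ℤ-Ring
import Data.Nat.Tactic.RingSolver as ℕ-Ring
open import Data.List using (List; []; _∷_; _++_; [_]; reverse; map; length; take; drop)
import Data.List.Properties as LP
open import Data.List.Relation.Unary.All using (All; []; _∷_)
open import Data.Product using (Σ; _×_; _,_; proj₁; proj₂)
open import Data.Sum using (inj₁; inj₂)
open import Data.Empty using (⊥-elim)
open import Data.Unit using (tt)
open import Function.Bundles using (_↔_; mk↔ₛ′)
open import Function.Properties.Inverse using (↔-sym; ↔-trans; ↔⇒⤖)
open import Relation.Binary.PropositionalEquality hiding ([_])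
open import Relation.Nullary using (Irrelevant)
open import Axiom.UniquenessOfIdentityProofs.WithK using (uip)

-- The bijection is
-- the composite of three bijections, each given by explicit inverse maps.
--  1. A symmetric path is H · mid · reflect H, where the middle is empty or a
--     single horizontal step of width l < K; it is a Dyck path iff H never
--     goes below the axis.  So symmetric Dyck paths of doubled width 4m are
--     the pairs (H, l) with width H + l = 2m ("Halves", module Symmetric).
--  2. Turning into up steps those down steps of a path that reach a new
--     minimum ("lifting") maps paths ending at height 0 or -1 bijectively
--     onto paths never going below the axis; it is undone by lifting the
--     reversed path from half its final height (Lifting, Unlifting).  As K
--     is odd, the final height of H has the parity of l, so the pairs (H, l)
--     correspond to pairs (P, l) with P ending at height -(l mod 2)
--     ("Lowered", module Lowering).
--  3. A case analysis on l and on the first step of P identifies these pairs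
--     with the paths of Q'(m,k) (module Folding).
-- All conditions involved are proof-irrelevant, so every bijection is checked
-- on the underlying paths only (mk↔-Σ).

Σ-≡ : {A : Set} {P : A → Set} → (∀ a → Irrelevant (P a)) → {x y : Σ A P} → proj₁ x ≡ proj₁ y → x ≡ y
Σ-≡ irr {a , u} {.a , v} refl = cong (a ,_) (irr a u v)

mk↔-Σ : {A B : Set} {P : A → Set} {Q : B → Set} →
  (∀ a → Irrelevant (P a)) → (∀ b → Irrelevant (Q b)) →
  (to : Σ A P → Σ B Q) (from : Σ B Q → Σ A P) →
  (∀ y → proj₁ (to (from y)) ≡ proj₁ y) → (∀ x → proj₁ (from (to x)) ≡ proj₁ x) → Σ A P ↔ Σ B Q
mk↔-Σ irrP irrQ to from to∘from from∘to =
  mk↔ₛ′ to from (λ y → Σ-≡ irrQ (to∘from y)) (λ x → Σ-≡ irrP (from∘to x))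

++-cancel-length : {A : Set} (xs ys : List A) {us vs : List A} →
  length xs ≡ length ys → xs ++ us ≡ ys ++ vs → (xs ≡ ys) × (us ≡ vs)
++-cancel-length [] [] _ e = refl , e
++-cancel-length (x ∷ xs) (y ∷ ys) ℓ e with ++-cancel-length xs ys (ℕP.suc-injective ℓ) (LP.∷-injectiveʳ e)
... | xs≡ys , us≡vs = cong₂ _∷_ (LP.∷-injectiveˡ e) xs≡ys , us≡vs

module Paths (K : ℕ) where

  Path : Set
  Path = List (Step K)

  reflectStep-involutive : (x : Step K) → reflectStep (reflectStep x) ≡ x
  reflectStep-involutive up = refl
  reflectStep-involutive down = refl
  reflectStep-involutive (hor _ _ _) = refl

  reflect-∷ : (x : Step K) (xs : Path) → reflect (x ∷ xs) ≡ reflect xs ++ [ reflectStep x ]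
  reflect-∷ x xs = LP.unfold-reverse (reflectStep x) (map reflectStep xs)

  reflect-++ : (xs ys : Path) → reflect (xs ++ ys) ≡ reflect ys ++ reflect xs
  reflect-++ xs ys = trans (cong reverse (LP.map-++ reflectStep xs ys))
                           (LP.reverse-++ (map reflectStep xs) (map reflectStep ys))

  reflect-involutive : (xs : Path) → reflect (reflect xs) ≡ xs
  reflect-involutive xs = begin
      reverse (map reflectStep (reverse (map reflectStep xs)))
        ≡⟨ cong reverse (LP.reverse-map reflectStep (map reflectStep xs)) ⟩
      reverse (reverse (map reflectStep (map reflectStep xs)))
        ≡⟨ LP.reverse-involutive _ ⟩
      map reflectStep (map reflectStep xs)
        ≡⟨ LP.map-∘ xs ⟨
      map (λ x → reflectStep (reflectStep x)) xs
        ≡⟨ LP.map-id-local (all-involutive xs) ⟩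
      xs ∎
    where
    open ≡-Reasoning
    all-involutive : (ys : Path) → All (λ y → reflectStep (reflectStep y) ≡ y) ys
    all-involutive [] = []
    all-involutive (y ∷ ys) = reflectStep-involutive y ∷ all-involutive ys

  length-reflect : (xs : Path) → length (reflect xs) ≡ length xs
  length-reflect xs = trans (LP.length-reverse (map reflectStep xs)) (LP.length-map reflectStep xs)

  width : Path → ℕ
  width [] = 0
  width (s ∷ p) = width2 s + width p

  totalWidth2≡width : (p : Path) → totalWidth2 p ≡ + width p
  totalWidth2≡width [] = refl
  totalWidth2≡width (s ∷ p) = cong (λ z → + width2 s ℤ.+ z) (totalWidth2≡width p)

  width-++ : (xs ys : Path) → width (xs ++ ys) ≡ width xs + width ys
  width-++ [] ys = refl
  width-++ (x ∷ xs) ys = trans (cong (λ z → width2 x + z) (width-++ xs ys)) (sym (ℕP.+-assoc (width2 x) _ _))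

  width-reflect : (xs : Path) → width (reflect xs) ≡ width xs
  width-reflect [] = refl
  width-reflect (x ∷ xs) = begin
      width (reflect (x ∷ xs))                     ≡⟨ cong width (reflect-∷ x xs) ⟩
      width (reflect xs ++ [ reflectStep x ])       ≡⟨ width-++ (reflect xs) _ ⟩
      width (reflect xs) + (width2 (reflectStep x) + 0)
        ≡⟨ cong₂ _+_ (width-reflect xs) (trans (ℕP.+-identityʳ _) (width-reflectStep x)) ⟩
      width xs + width2 x                           ≡⟨ ℕP.+-comm (width xs) _ ⟩
      width2 x + width xs ∎
    where
    open ≡-Reasoning
    width-reflectStep : (y : Step K) → width2 (reflectStep y) ≡ width2 y
    width-reflectStep up = refl
    width-reflectStep down = refl
    width-reflectStep (hor _ _ _) = refl

  R : Path → ℤ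
  R = totalRise

  rise-++ : (xs ys : Path) → R (xs ++ ys) ≡ R xs ℤ.+ R ys
  rise-++ [] ys = sym (ℤP.+-identityˡ _)
  rise-++ (x ∷ xs) ys = trans (cong (λ z → rise x ℤ.+ z) (rise-++ xs ys)) (sym (ℤP.+-assoc (rise x) _ _))

  rise-reflectStep : (x : Step K) → rise (reflectStep x) ≡ ℤ.- rise x
  rise-reflectStep up = refl
  rise-reflectStep down = refl
  rise-reflectStep (hor _ _ _) = refl

  rise-reflect : (xs : Path) → R (reflect xs) ≡ ℤ.- R xs
  rise-reflect [] = refl
  rise-reflect (x ∷ xs) = begin
      R (reflect (x ∷ xs))                     ≡⟨ cong R (reflect-∷ x xs) ⟩
      R (reflect xs ++ [ reflectStep x ])       ≡⟨ rise-++ (reflect xs) _ ⟩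
      R (reflect xs) ℤ.+ (rise (reflectStep x) ℤ.+ 0ℤ)
        ≡⟨ cong₂ ℤ._+_ (rise-reflect xs) (trans (ℤP.+-identityʳ _) (rise-reflectStep x)) ⟩
      ℤ.- R xs ℤ.+ ℤ.- rise x                  ≡⟨ ℤP.neg-distrib-+ (R xs) (rise x) ⟨
      ℤ.- (R xs ℤ.+ rise x)                    ≡⟨ cong ℤ.-_ (ℤP.+-comm (R xs) (rise x)) ⟩
      ℤ.- (rise x ℤ.+ R xs) ∎
    where open ≡-Reasoning

  hor-irrelevant : {ℓ : ℕ} (a a′ : 1 ≤ ℓ) (b b′ : ℓ < K) → hor ℓ a b ≡ hor ℓ a′ b′
  hor-irrelevant a a′ b b′ = cong₂ (hor _) (ℕP.≤-irrelevant a a′) (ℕP.<-irrelevant b b′)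

  NB : ℤ → Path → Set
  NB = NeverBelowFrom

  nb-irrelevant : (h : ℤ) (p : Path) → Irrelevant (NB h p)
  nb-irrelevant h [] tt tt = refl
  nb-irrelevant h (x ∷ p) (a , as) (b , bs) = cong₂ _,_ (ℤP.≤-irrelevant a b) (nb-irrelevant _ p as bs)

  nb-++⁻ˡ : (h : ℤ) (xs ys : Path) → NB h (xs ++ ys) → NB h xs
  nb-++⁻ˡ h [] ys _ = tt
  nb-++⁻ˡ h (x ∷ xs) ys (p , nb) = p , nb-++⁻ˡ (h ℤ.+ rise x) xs ys nb

  nb-++⁺ : (h : ℤ) (xs ys : Path) → NB h xs → NB (h ℤ.+ R xs) ys → NB h (xs ++ ys)
  nb-++⁺ h [] ys _ nb = subst (λ z → NB z ys) (ℤP.+-identityʳ h) nb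
  nb-++⁺ h (x ∷ xs) ys (p , a) nb =
    p , nb-++⁺ (h ℤ.+ rise x) xs ys a (subst (λ z → NB z ys) (sym (ℤP.+-assoc h (rise x) (R xs))) nb)

  nb-end : (h : ℤ) (p : Path) → 0ℤ ℤ.≤ h → NB h p → 0ℤ ℤ.≤ h ℤ.+ R p
  nb-end h [] h≥0 _ = subst (0ℤ ℤ.≤_) (sym (ℤP.+-identityʳ h)) h≥0
  nb-end h (x ∷ p) _ (q , nb) = subst (0ℤ ℤ.≤_) (ℤP.+-assoc h (rise x) (R p)) (nb-end (h ℤ.+ rise x) p q nb)

  nb-reflect : (h : ℤ) (xs : Path) → 0ℤ ℤ.≤ h → NB h xs → NB (h ℤ.+ R xs) (reflect xs)
  nb-reflect h [] _ _ = tt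
  nb-reflect h (x ∷ xs) h≥0 (q , nb) =
    subst (NB (h ℤ.+ R (x ∷ xs))) (sym (reflect-∷ x xs))
      (nb-++⁺ _ (reflect xs) [ reflectStep x ] nb-init (subst (0ℤ ℤ.≤_) (sym returns) h≥0 , tt))
    where
    nb-init : NB (h ℤ.+ R (x ∷ xs)) (reflect xs)
    nb-init = subst (λ z → NB z (reflect xs)) (ℤP.+-assoc h (rise x) (R xs))
                    (nb-reflect (h ℤ.+ rise x) xs q nb)
    returns : h ℤ.+ R (x ∷ xs) ℤ.+ R (reflect xs) ℤ.+ rise (reflectStep x) ≡ h
    returns = begin
        h ℤ.+ (rise x ℤ.+ R xs) ℤ.+ R (reflect xs) ℤ.+ rise (reflectStep x)
          ≡⟨ cong₂ (λ a b → h ℤ.+ (rise x ℤ.+ R xs) ℤ.+ a ℤ.+ b) (rise-reflect xs) (rise-reflectStep x) ⟩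
        h ℤ.+ (rise x ℤ.+ R xs) ℤ.+ ℤ.- R xs ℤ.+ ℤ.- rise x
          ≡⟨ there-and-back h (rise x) (R xs) ⟩
        h ∎
      where
      open ≡-Reasoning
      there-and-back : ∀ a b c → a ℤ.+ (b ℤ.+ c) ℤ.+ ℤ.- c ℤ.+ ℤ.- b ≡ a
      there-and-back = ℤ-Ring.solve-∀

-- Scanning a path from the left while tracking how far it
-- lies above its lowest point so far (started with slack d), every down step
-- that would create a new minimum is turned into an up step.  The result
-- never goes below the axis, and reading the result backwards with the final
-- slack undoes the lifting; this is the heart of the bijection.
module Lifting (K : ℕ) where
  open Paths K

  liftStep : ℕ → Step K → Step K
  liftStep d up = up
  liftStep zero down = up
  liftStep (suc d) down = down
  liftStep d (hor ℓ a b) = hor ℓ a b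

  slackStep : ℕ → Step K → ℕ
  slackStep d up = suc d
  slackStep zero down = zero
  slackStep (suc d) down = d
  slackStep d (hor _ _ _) = d

  lift : ℕ → Path → Path
  lift d [] = []
  lift d (x ∷ p) = liftStep d x ∷ lift (slackStep d x) p

  slack : ℕ → Path → ℕ
  slack d [] = d
  slack d (x ∷ p) = slack (slackStep d x) p

  lift-++ : (d : ℕ) (xs ys : Path) → lift d (xs ++ ys) ≡ lift d xs ++ lift (slack d xs) ys
  lift-++ d [] ys = refl
  lift-++ d (x ∷ xs) ys = cong (liftStep d x ∷_) (lift-++ (slackStep d x) xs ys)

  slack-++ : (d : ℕ) (xs ys : Path) → slack d (xs ++ ys) ≡ slack (slack d xs) ys
  slack-++ d [] ys = refl
  slack-++ d (x ∷ xs) ys = slack-++ (slackStep d x) xs ys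

  liftStep-reflect : (d : ℕ) (x : Step K) →
    liftStep (slackStep d x) (reflectStep (liftStep d x)) ≡ reflectStep x
  liftStep-reflect d up = refl
  liftStep-reflect zero down = refl
  liftStep-reflect (suc d) down = refl
  liftStep-reflect d (hor _ _ _) = refl

  slackStep-reflect : (d : ℕ) (x : Step K) →
    slackStep (slackStep d x) (reflectStep (liftStep d x)) ≡ d
  slackStep-reflect d up = refl
  slackStep-reflect zero down = refl
  slackStep-reflect (suc d) down = refl
  slackStep-reflect d (hor _ _ _) = refl

  lift-reflect-lift : (d : ℕ) (X : Path) →
    (lift (slack d X) (reflect (lift d X)) ≡ reflect X) × (slack (slack d X) (reflect (lift d X)) ≡ d)
  lift-reflect-lift d [] = refl , refl
  lift-reflect-lift d (x ∷ X) = lifts , slacks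
    where
    d′ : ℕ
    d′ = slackStep d x
    e : ℕ
    e = slack d′ X
    Y : Path
    Y = lift d′ X
    y : Step K
    y = reflectStep (liftStep d x)
    IH : (lift e (reflect Y) ≡ reflect X) × (slack e (reflect Y) ≡ d′)
    IH = lift-reflect-lift d′ X
    lifts : lift e (reflect (liftStep d x ∷ Y)) ≡ reflect (x ∷ X)
    lifts = begin
        lift e (reflect (liftStep d x ∷ Y))        ≡⟨ cong (lift e) (reflect-∷ (liftStep d x) Y) ⟩
        lift e (reflect Y ++ [ y ])                ≡⟨ lift-++ e (reflect Y) [ y ] ⟩
        lift e (reflect Y) ++ lift (slack e (reflect Y)) [ y ]
          ≡⟨ cong₂ _++_ (proj₁ IH) (cong (λ z → lift z [ y ]) (proj₂ IH)) ⟩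
        reflect X ++ [ liftStep d′ y ]              ≡⟨ cong (λ z → reflect X ++ [ z ]) (liftStep-reflect d x) ⟩
        reflect X ++ [ reflectStep x ]              ≡⟨ reflect-∷ x X ⟨
        reflect (x ∷ X) ∎
      where open ≡-Reasoning
    slacks : slack e (reflect (liftStep d x ∷ Y)) ≡ d
    slacks = begin
        slack e (reflect (liftStep d x ∷ Y))       ≡⟨ cong (slack e) (reflect-∷ (liftStep d x) Y) ⟩
        slack e (reflect Y ++ [ y ])               ≡⟨ slack-++ e (reflect Y) [ y ] ⟩
        slack (slack e (reflect Y)) [ y ]          ≡⟨ cong (λ z → slack z [ y ]) (proj₂ IH) ⟩
        slackStep d′ y                             ≡⟨ slackStep-reflect d x ⟩
        d ∎
      where open ≡-Reasoning

  width-lift : (d : ℕ) (X : Path) → width (lift d X) ≡ width X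
  width-lift d [] = refl
  width-lift d (x ∷ X) = cong₂ _+_ (width-liftStep d x) (width-lift (slackStep d x) X)
    where
    width-liftStep : (d : ℕ) (x : Step K) → width2 (liftStep d x) ≡ width2 x
    width-liftStep d up = refl
    width-liftStep zero down = refl
    width-liftStep (suc d) down = refl
    width-liftStep d (hor _ _ _) = refl

  +suc : (q : ℕ) → + q ℤ.+ + 1 ≡ + suc q
  +suc q = cong +_ (ℕP.+-comm q 1)

  -- Each flipped step raises the endpoint by two, and the slack records it:
  -- 2·(final slack) = 2d + rise X + rise (lift d X).
  rise-liftStep : (d : ℕ) (x : Step K) →
    + (slackStep d x * 2) ≡ + (d * 2) ℤ.+ rise x ℤ.+ rise (liftStep d x)
  rise-liftStep d up = sym (trans (cong (ℤ._+ + 1) (+suc (d * 2))) (+suc (suc (d * 2))))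
  rise-liftStep zero down = refl
  rise-liftStep (suc d) down = refl
  rise-liftStep d (hor _ _ _) = sym (trans (ℤP.+-identityʳ _) (ℤP.+-identityʳ _))

  rise-lift : (d : ℕ) (X : Path) → + (slack d X * 2) ≡ + (d * 2) ℤ.+ R X ℤ.+ R (lift d X)
  rise-lift d [] = sym (trans (ℤP.+-identityʳ _) (ℤP.+-identityʳ _))
  rise-lift d (x ∷ X) = begin
      + (slack d′ X * 2)                                      ≡⟨ rise-lift d′ X ⟩
      + (d′ * 2) ℤ.+ R X ℤ.+ R (lift d′ X)
        ≡⟨ cong (λ z → z ℤ.+ R X ℤ.+ R (lift d′ X)) (rise-liftStep d x) ⟩
      + (d * 2) ℤ.+ rise x ℤ.+ rise (liftStep d x) ℤ.+ R X ℤ.+ R (lift d′ X)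
        ≡⟨ regroup (+ (d * 2)) (rise x) (rise (liftStep d x)) (R X) _ ⟩
      + (d * 2) ℤ.+ (rise x ℤ.+ R X) ℤ.+ (rise (liftStep d x) ℤ.+ R (lift d′ X)) ∎
    where
    open ≡-Reasoning
    d′ : ℕ
    d′ = slackStep d x
    regroup : ∀ a b c e f → a ℤ.+ b ℤ.+ c ℤ.+ e ℤ.+ f ≡ a ℤ.+ (b ℤ.+ e) ℤ.+ (c ℤ.+ f)
    regroup = ℤ-Ring.solve-∀

  -- Started at height q with slack at most q, the lifted path stays above
  -- the axis: its height is always at least the current slack.
  nb-lift : (q d : ℕ) (X : Path) → d ≤ q → NB (+ q) (lift d X)
  nb-lift q d [] _ = tt
  nb-lift q d (up ∷ X) d≤q =
    ℤ.+≤+ z≤n , subst (λ z → NB z (lift (suc d) X)) (sym (+suc q)) (nb-lift (suc q) (suc d) X (s≤s d≤q))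
  nb-lift q zero (down ∷ X) _ =
    ℤ.+≤+ z≤n , subst (λ z → NB z (lift zero X)) (sym (+suc q)) (nb-lift (suc q) zero X z≤n)
  nb-lift (suc q) (suc d) (down ∷ X) (s≤s d≤q) = ℤ.+≤+ z≤n , nb-lift q d X d≤q
  nb-lift q d (hor _ _ _ ∷ X) d≤q =
    ℤ.+≤+ z≤n , subst (λ z → NB z (lift d X)) (sym (ℤP.+-identityʳ (+ q))) (nb-lift q d X d≤q)

  down-step : ∀ a b → a ℤ.+ b ≡ (+ 1 ℤ.+ a) ℤ.+ (-[1+ 0 ] ℤ.+ b)
  down-step = ℤ-Ring.solve-∀

  slack-exhausted : (q d : ℕ) (X : Path) → d ≤ q → NB (+ q) X → + q ℤ.+ R X ≡ 0ℤ → slack d X ≡ 0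
  slack-exhausted q zero [] _ _ _ = refl
  slack-exhausted q (suc d) [] (s≤s _) _ e with trans (sym (ℤP.+-identityʳ (+ q))) e
  ... | ()
  slack-exhausted q d (up ∷ X) d≤q (_ , nb) e =
    slack-exhausted (suc q) (suc d) X (s≤s d≤q) (subst (λ z → NB z X) (+suc q) nb)
      (trans (cong (ℤ._+ R X) (sym (+suc q))) (trans (ℤP.+-assoc (+ q) (+ 1) (R X)) e))
  slack-exhausted zero d (down ∷ X) _ (() , _) _
  slack-exhausted (suc q) zero (down ∷ X) _ (_ , nb) e = slack-exhausted q zero X z≤n nb (trans (down-step (+ q) (R X)) e)
  slack-exhausted (suc q) (suc d) (down ∷ X) (s≤s d≤q) (_ , nb) e = slack-exhausted q d X d≤q nb (trans (down-step (+ q) (R X)) e)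
  slack-exhausted q d (hor _ _ _ ∷ X) d≤q (_ , nb) e =
    slack-exhausted q d X d≤q (subst (λ z → NB z X) (ℤP.+-identityʳ (+ q)) nb)
      (trans (cong (ℤ._+ R X) (sym (ℤP.+-identityʳ (+ q)))) (trans (ℤP.+-assoc (+ q) 0ℤ (R X)) e))

half-of : {e : ℕ} (f : ℕ) → e < 2 → (e + f * 2) / 2 ≡ f
half-of {e} f e<2 = trans (+-distrib-/-∣ʳ e (divides f refl)) (cong₂ _+_ (m<n⇒m/n≡0 e<2) (m*n/n≡m f 2))

parity-transfer : (a b c : ℕ) → a + b ≡ c * 2 → a % 2 ≡ b % 2
parity-transfer a b c a+b≡2c = begin
    a % 2             ≡⟨ [m+kn]%n≡m%n a c 2 ⟨
    (a + c * 2) % 2   ≡⟨ cong (λ z → (a + z) % 2) a+b≡2c ⟨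
    (a + (a + b)) % 2 ≡⟨ cong (_% 2) (rearrange a b) ⟩
    (b + a * 2) % 2   ≡⟨ [m+kn]%n≡m%n b a 2 ⟩
    b % 2 ∎
  where
  open ≡-Reasoning
  rearrange : ∀ x y → x + (x + y) ≡ y + x * 2
  rearrange = ℕ-Ring.solve-∀

module Unlifting (K : ℕ) where
  open Paths K
  open Lifting K

  height : Path → ℕ
  height H = ℤ.∣ R H ∣

  +height : (H : Path) → NB 0ℤ H → + height H ≡ R H
  +height H nb = ℤP.0≤i⇒+∣i∣≡i (subst (0ℤ ℤ.≤_) (ℤP.+-identityˡ (R H)) (nb-end 0ℤ H (ℤ.+≤+ z≤n) nb))

  unlift : Path → Path
  unlift H = reflect (lift (height H / 2) (reflect H))

  width-unlift : (H : Path) → width (unlift H) ≡ width H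
  width-unlift H = begin
    width (reflect (lift (height H / 2) (reflect H))) ≡⟨ width-reflect (lift (height H / 2) (reflect H)) ⟩
    width (lift (height H / 2) (reflect H))           ≡⟨ width-lift _ (reflect H) ⟩
    width (reflect H)                                 ≡⟨ width-reflect H ⟩
    width H ∎
    where open ≡-Reasoning

  -- The reversed path runs from height q back to the axis, so the slack
  -- ⌊q/2⌋ is used up completely.
  slack-unlift : (H : Path) → NB 0ℤ H → slack (height H / 2) (reflect H) ≡ 0
  slack-unlift H nb = slack-exhausted q (q / 2) (reflect H) (m/n≤m q 2) nb-reversed returns
    where
    q : ℕ
    q = height H
    nb-reversed : NB (+ q) (reflect H)
    nb-reversed = subst (λ z → NB z (reflect H)) (trans (ℤP.+-identityˡ (R H)) (sym (+height H nb)))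
                        (nb-reflect 0ℤ H (ℤ.+≤+ z≤n) nb)
    returns : + q ℤ.+ R (reflect H) ≡ 0ℤ
    returns = trans (cong₂ ℤ._+_ (+height H nb) (rise-reflect H)) (ℤP.+-inverseʳ (R H))

  lift-unlift : (H : Path) → NB 0ℤ H → lift 0 (unlift H) ≡ H
  lift-unlift H nb = begin
    lift 0 (reflect (lift d X))                ≡⟨ cong (λ z → lift z (reflect (lift d X))) (slack-unlift H nb) ⟨
    lift (slack d X) (reflect (lift d X))      ≡⟨ proj₁ (lift-reflect-lift d X) ⟩
    reflect X                                  ≡⟨ reflect-involutive H ⟩
    H ∎
    where
    open ≡-Reasoning
    d : ℕ
    d = height H / 2
    X : Path
    X = reflect H

  -- The unlifted path ends at height -(q mod 2): by rise-lift with final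
  -- slack 0, lifting the reversed path from slack ⌊q/2⌋ rises by q - 2⌊q/2⌋.
  rise-unlift : (H : Path) → NB 0ℤ H → R (unlift H) ≡ ℤ.- + (height H % 2)
  rise-unlift H nb = trans (rise-reflect (lift d X)) (cong ℤ.-_ lifted-rise)
    where
    q : ℕ
    q = height H
    d : ℕ
    d = q / 2
    X : Path
    X = reflect H
    A : ℤ
    A = + (d * 2)
    C : ℤ
    C = R (lift d X)
    no-slack : 0ℤ ≡ A ℤ.+ R X ℤ.+ C
    no-slack = trans (cong (λ z → + (z * 2)) (sym (slack-unlift H nb))) (rise-lift d X)
    q-split : R H ≡ + (q % 2) ℤ.+ A
    q-split = trans (sym (+height H nb)) (trans (cong +_ (m≡m%n+[m/n]*n q 2)) (ℤP.pos-+ (q % 2) (d * 2)))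
    lifted-rise : C ≡ + (q % 2)
    lifted-rise = begin
        C                                     ≡⟨ isolate A (R X) C ⟩
        (A ℤ.+ R X ℤ.+ C) ℤ.- A ℤ.- R X       ≡⟨ cong (λ z → z ℤ.- A ℤ.- R X) no-slack ⟨
        0ℤ ℤ.- A ℤ.- R X                      ≡⟨ cong (λ z → 0ℤ ℤ.- A ℤ.- z) (rise-reflect H) ⟩
        0ℤ ℤ.- A ℤ.- ℤ.- R H                  ≡⟨ cong (λ z → 0ℤ ℤ.- A ℤ.- ℤ.- z) q-split ⟩
        0ℤ ℤ.- A ℤ.- ℤ.- (+ (q % 2) ℤ.+ A)    ≡⟨ cancel A (+ (q % 2)) ⟩
        + (q % 2) ∎
      where
      open ≡-Reasoning
      isolate : ∀ a b c → c ≡ (a ℤ.+ b ℤ.+ c) ℤ.- a ℤ.- b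
      isolate = ℤ-Ring.solve-∀
      cancel : ∀ a e → 0ℤ ℤ.- a ℤ.- ℤ.- (e ℤ.+ a) ≡ e
      cancel = ℤ-Ring.solve-∀

  -- Conversely, a path ending at height -e (e ∈ {0,1}) is recovered from
  -- its lifting, which ends at height e + 2·(final slack).
  unlift-lift : {e : ℕ} (P : Path) → e < 2 → R P ≡ ℤ.- + e → unlift (lift 0 P) ≡ P
  unlift-lift {e} P e<2 rP = begin
      reflect (lift (height H / 2) (reflect H))   ≡⟨ cong (λ z → reflect (lift z (reflect H))) half-height ⟩
      reflect (lift f (reflect H))                ≡⟨ cong reflect (proj₁ (lift-reflect-lift 0 P)) ⟩
      reflect (reflect P)                         ≡⟨ reflect-involutive P ⟩
      P ∎
    where
    open ≡-Reasoning
    H : Path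
    H = lift 0 P
    f : ℕ
    f = slack 0 P
    height-H : + height H ≡ + (e + f * 2)
    height-H = begin
        + height H                            ≡⟨ +height H (nb-lift 0 0 P z≤n) ⟩
        R H                                   ≡⟨ isolate (R H) (R P) ⟩
        ℤ.- R P ℤ.+ (0ℤ ℤ.+ R P ℤ.+ R H)      ≡⟨ cong₂ (λ a b → ℤ.- a ℤ.+ b) rP (sym (rise-lift 0 P)) ⟩
        ℤ.- ℤ.- + e ℤ.+ + (f * 2)             ≡⟨ cong (ℤ._+ + (f * 2)) (ℤP.neg-involutive (+ e)) ⟩
        + e ℤ.+ + (f * 2)                     ≡⟨ ℤP.pos-+ e (f * 2) ⟨
        + (e + f * 2) ∎
      where
      isolate : ∀ a b → a ≡ ℤ.- b ℤ.+ (0ℤ ℤ.+ b ℤ.+ a)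
      isolate = ℤ-Ring.solve-∀
    half-height : height H / 2 ≡ f
    half-height = trans (cong (_/ 2) (ℤP.+-injective height-H)) (half-of f e<2)

module Symmetric (K : ℕ) (0<K : 0 < K) where
  open Paths K

  mid : (l : ℕ) → l < K → Path
  mid zero _ = []
  mid (suc l) l<K = [ hor (suc l) (s≤s z≤n) l<K ]

  build : Path → (l : ℕ) → l < K → Path
  build H l l<K = H ++ (mid l l<K ++ reflect H)

  width-mid : (l : ℕ) (l<K : l < K) → width (mid l l<K) ≡ 2 * l
  width-mid zero _ = refl
  width-mid (suc l) _ = ℕP.+-identityʳ _

  rise-mid : (l : ℕ) (l<K : l < K) → R (mid l l<K) ≡ 0ℤ
  rise-mid zero _ = refl
  rise-mid (suc l) _ = refl

  nb-mid : (h : ℤ) (l : ℕ) (l<K : l < K) → 0ℤ ℤ.≤ h → NB h (mid l l<K)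
  nb-mid h zero _ _ = tt
  nb-mid h (suc l) _ h≥0 = subst (0ℤ ℤ.≤_) (sym (ℤP.+-identityʳ h)) h≥0 , tt

  reflect-mid : (l : ℕ) (l<K : l < K) → reflect (mid l l<K) ≡ mid l l<K
  reflect-mid zero _ = refl
  reflect-mid (suc l) _ = refl

  length-mid : (l : ℕ) (l<K : l < K) → length (mid l l<K) < 2
  length-mid zero _ = s≤s z≤n
  length-mid (suc l) _ = s≤s (s≤s z≤n)

  width-build : (H : Path) (l : ℕ) (l<K : l < K) → width (build H l l<K) ≡ 2 * (width H + l)
  width-build H l l<K = begin
      width (H ++ (mid l l<K ++ reflect H))              ≡⟨ width-++ H _ ⟩
      width H + width (mid l l<K ++ reflect H)           ≡⟨ cong (λ z → width H + z) (width-++ (mid l l<K) (reflect H)) ⟩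
      width H + (width (mid l l<K) + width (reflect H))
        ≡⟨ cong₂ (λ a b → width H + (a + b)) (width-mid l l<K) (width-reflect H) ⟩
      width H + (2 * l + width H)                        ≡⟨ rearrange (width H) l ⟩
      2 * (width H + l) ∎
    where
    open ≡-Reasoning
    rearrange : ∀ a b → a + (2 * b + a) ≡ 2 * (a + b)
    rearrange = ℕ-Ring.solve-∀

  rise-build : (H : Path) (l : ℕ) (l<K : l < K) → R (build H l l<K) ≡ 0ℤ
  rise-build H l l<K = begin
      R (H ++ (mid l l<K ++ reflect H))            ≡⟨ rise-++ H _ ⟩
      R H ℤ.+ R (mid l l<K ++ reflect H)           ≡⟨ cong (λ z → R H ℤ.+ z) (rise-++ (mid l l<K) (reflect H)) ⟩
      R H ℤ.+ (R (mid l l<K) ℤ.+ R (reflect H))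
        ≡⟨ cong₂ (λ a b → R H ℤ.+ (a ℤ.+ b)) (rise-mid l l<K) (rise-reflect H) ⟩
      R H ℤ.+ (0ℤ ℤ.+ ℤ.- R H)                     ≡⟨ cong (λ z → R H ℤ.+ z) (ℤP.+-identityˡ (ℤ.- R H)) ⟩
      R H ℤ.+ ℤ.- R H                              ≡⟨ ℤP.+-inverseʳ (R H) ⟩
      0ℤ ∎
    where open ≡-Reasoning

  nb-build : (H : Path) (l : ℕ) (l<K : l < K) → NB 0ℤ H → NB 0ℤ (build H l l<K)
  nb-build H l l<K nb =
    nb-++⁺ 0ℤ H _ nb (nb-++⁺ _ (mid l l<K) (reflect H) (nb-mid _ l l<K end≥0)
      (subst (λ z → NB z (reflect H)) (trans (sym (ℤP.+-identityʳ _)) (cong (λ z → 0ℤ ℤ.+ R H ℤ.+ z) (sym (rise-mid l l<K))))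
        (nb-reflect 0ℤ H (ℤ.+≤+ z≤n) nb)))
    where
    end≥0 : 0ℤ ℤ.≤ 0ℤ ℤ.+ R H
    end≥0 = nb-end 0ℤ H (ℤ.+≤+ z≤n) nb

  reflect-build : (H : Path) (l : ℕ) (l<K : l < K) → reflect (build H l l<K) ≡ build H l l<K
  reflect-build H l l<K = begin
      reflect (H ++ (mid l l<K ++ reflect H))                   ≡⟨ reflect-++ H _ ⟩
      reflect (mid l l<K ++ reflect H) ++ reflect H             ≡⟨ cong (_++ reflect H) (reflect-++ (mid l l<K) (reflect H)) ⟩
      (reflect (reflect H) ++ reflect (mid l l<K)) ++ reflect H
        ≡⟨ cong₂ (λ a b → (a ++ b) ++ reflect H) (reflect-involutive H) (reflect-mid l l<K) ⟩
      (H ++ mid l l<K) ++ reflect H                             ≡⟨ LP.++-assoc H (mid l l<K) (reflect H) ⟩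
      build H l l<K ∎
    where open ≡-Reasoning

  length-build : (H : Path) (l : ℕ) (l<K : l < K) → length (build H l l<K) ≡ length (mid l l<K) + length H * 2
  length-build H l l<K = begin
      length (H ++ (mid l l<K ++ reflect H))                    ≡⟨ LP.length-++ H ⟩
      length H + length (mid l l<K ++ reflect H)                ≡⟨ cong (λ z → length H + z) (LP.length-++ (mid l l<K)) ⟩
      length H + (length (mid l l<K) + length (reflect H))      ≡⟨ cong (λ z → length H + (length (mid l l<K) + z)) (length-reflect H) ⟩
      length H + (length (mid l l<K) + length H)                ≡⟨ rearrange (length H) (length (mid l l<K)) ⟩
      length (mid l l<K) + length H * 2 ∎
    where
    open ≡-Reasoning
    rearrange : ∀ a b → a + (b + a) ≡ b + a * 2
    rearrange = ℕ-Ring.solve-∀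

  -- The first half is determined by the whole path: it is the first
  -- ⌊length/2⌋ steps.
  build-injective : (H : Path) (l : ℕ) (l<K : l < K) (H′ : Path) (l′ : ℕ) (l′<K : l′ < K) →
    build H l l<K ≡ build H′ l′ l′<K → H ≡ H′
  build-injective H l l<K H′ l′ l′<K e = proj₁ (++-cancel-length H H′ same-length e)
    where
    same-length : length H ≡ length H′
    same-length = begin
      length H                        ≡⟨ half-of (length H) (length-mid l l<K) ⟨
      (length (mid l l<K) + length H * 2) / 2   ≡⟨ cong (_/ 2) (length-build H l l<K) ⟨
      length (build H l l<K) / 2      ≡⟨ cong (λ S → length S / 2) e ⟩
      length (build H′ l′ l′<K) / 2   ≡⟨ cong (_/ 2) (length-build H′ l′ l′<K) ⟩
      (length (mid l′ l′<K) + length H′ * 2) / 2   ≡⟨ half-of (length H′) (length-mid l′ l′<K) ⟩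
      length H′ ∎
      where open ≡-Reasoning

  record Decomposition (S : Path) : Set where
    field
      half : Path
      middle : ℕ
      middle<K : middle < K
      decomposes : S ≡ build half middle middle<K

  -- Every symmetric path decomposes: split it after ⌊length/2⌋ steps; the
  -- second part is the reflection of the first, preceded by the middle step
  -- when the length is odd.
  symmetric-split : (S : Path) → reflect S ≡ S → Decomposition S
  symmetric-split S symmetric = by-parity (n % 2) (m%n<n n 2) (drop h S) length-B (sym (LP.take++drop≡id h S)) mirrored
    where
    n : ℕ
    n = length S
    h : ℕ
    h = n / 2
    A : Path
    A = take h S
    length-A : length A ≡ h
    length-A = trans (LP.length-take h S) (ℕP.m≤n⇒m⊓n≡m (m/n≤m n 2))
    length-B : length (drop h S) ≡ n % 2 + h
    length-B = begin
      length (drop h S)      ≡⟨ LP.length-drop h S ⟩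
      n ∸ h                  ≡⟨ cong (_∸ h) (m≡m%n+[m/n]*n n 2) ⟩
      (n % 2 + h * 2) ∸ h    ≡⟨ cong (_∸ h) (rearrange (n % 2) h) ⟩
      (n % 2 + h) + h ∸ h    ≡⟨ ℕP.m+n∸n≡m (n % 2 + h) h ⟩
      n % 2 + h ∎
      where
      open ≡-Reasoning
      rearrange : ∀ a b → a + b * 2 ≡ (a + b) + b
      rearrange = ℕ-Ring.solve-∀
    mirrored : reflect (drop h S) ++ reflect A ≡ A ++ drop h S
    mirrored = trans (sym (reflect-++ A (drop h S)))
                     (trans (cong reflect (LP.take++drop≡id h S)) (trans symmetric (sym (LP.take++drop≡id h S))))
    middle-step : (x : Step K) (D : Path) → reflectStep x ≡ x → reflect A ≡ D → S ≡ A ++ (x ∷ D) → Decomposition S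
    middle-step (hor (suc l) (s≤s z≤n) l<K) D _ reflectA≡D S≡ =
      record { half = A ; middle = suc l ; middle<K = l<K
             ; decomposes = trans S≡ (cong (λ z → A ++ (hor (suc l) (s≤s z≤n) l<K ∷ z)) (sym reflectA≡D)) }
    middle-step up D () _ _
    middle-step down D () _ _
    by-parity : (e : ℕ) → e < 2 → (B : Path) → length B ≡ e + h →
                S ≡ A ++ B → reflect B ++ reflect A ≡ A ++ B → Decomposition S
    by-parity zero _ B ℓB S≡ mirror =
      record { half = A ; middle = 0 ; middle<K = 0<K
             ; decomposes = trans S≡ (cong (A ++_) (sym (proj₂ (++-cancel-length (reflect B) A same-length mirror)))) }
      where
      same-length : length (reflect B) ≡ length A
      same-length = trans (length-reflect B) (trans ℓB (sym length-A))
    by-parity (suc zero) _ [] () _ _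
    by-parity (suc zero) _ (x ∷ D) ℓB S≡ mirror =
      middle-step x D (LP.∷-injectiveˡ rest) (LP.∷-injectiveʳ rest) S≡
      where
      same-length : length (reflect D) ≡ length A
      same-length = trans (length-reflect D) (trans (ℕP.suc-injective ℓB) (sym length-A))
      mirror′ : reflect D ++ (reflectStep x ∷ reflect A) ≡ A ++ (x ∷ D)
      mirror′ = trans (sym (LP.++-assoc (reflect D) [ reflectStep x ] (reflect A)))
                      (trans (cong (_++ reflect A) (sym (reflect-∷ x D))) mirror)
      rest : reflectStep x ∷ reflect A ≡ x ∷ D
      rest = proj₂ (++-cancel-length (reflect D) A same-length mirror′)
    by-parity (suc (suc _)) (s≤s (s≤s ())) _ _ _ _

  -- First half and middle width of a symmetric Dyck path of width 2W.
  IsHalves : ℕ → Path × ℕ → Set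
  IsHalves W (H , l) = l < K × NB 0ℤ H × width H + l ≡ W

  Halves : ℕ → Set
  Halves W = Σ (Path × ℕ) (IsHalves W)

  halves-irrelevant : (W : ℕ) (Hl : Path × ℕ) → Irrelevant (IsHalves W Hl)
  halves-irrelevant W (H , l) (a , b , c) (a′ , b′ , c′) =
    cong₂ _,_ (ℕP.<-irrelevant a a′) (cong₂ _,_ (nb-irrelevant 0ℤ H b b′) (uip c c′))

  symmetric-halves : (W : ℕ) → SD K (+ (2 * W)) ↔ Halves W
  symmetric-halves W = mk↔-Σ sd-irrelevant (halves-irrelevant W) halve whole halve∘whole whole∘halve
    where
    sd-irrelevant : ∀ S → Irrelevant (IsSymDyck K (+ (2 * W)) S)
    sd-irrelevant S (((a , b) , c) , d) (((a′ , b′) , c′) , d′) =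
      cong₂ _,_ (cong₂ _,_ (cong₂ _,_ (uip a a′) (uip b b′)) (nb-irrelevant 0ℤ S c c′)) (uip d d′)
    halve : SD K (+ (2 * W)) → Halves W
    halve (S , ((w , _) , nb) , symmetric) =
      (half , middle) , middle<K , nb-++⁻ˡ 0ℤ half _ (subst (NB 0ℤ) decomposes nb) , width-half
      where
      open Decomposition (symmetric-split S symmetric)
      width-half : width half + middle ≡ W
      width-half = ℕP.*-cancelˡ-≡ _ _ 2 (begin
        2 * (width half + middle)              ≡⟨ width-build half middle middle<K ⟨
        width (build half middle middle<K)     ≡⟨ cong width decomposes ⟨
        width S                                ≡⟨ ℤP.+-injective (trans (sym (totalWidth2≡width S)) w) ⟩
        2 * W ∎)
        where open ≡-Reasoning
    whole : Halves W → SD K (+ (2 * W))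
    whole ((H , l) , l<K , nb , w) =
      build H l l<K ,
      ((trans (totalWidth2≡width (build H l l<K)) (cong +_ (trans (width-build H l l<K) (cong (2 *_) w))) , rise-build H l l<K)
        , nb-build H l l<K nb) ,
      reflect-build H l l<K
    halve∘whole : ∀ h → proj₁ (halve (whole h)) ≡ proj₁ h
    halve∘whole h@((H , l) , l<K , _ , w) =
      cong₂ _,_ half≡H (ℕP.+-cancelˡ-≡ (width H) _ _ (trans (cong (λ z → width z + middle) (sym half≡H)) (trans w′ (sym w))))
      where
      open Decomposition (symmetric-split (build H l l<K) (reflect-build H l l<K))
      half≡H : half ≡ H
      half≡H = build-injective half middle middle<K H l l<K (sym decomposes)
      w′ : width half + middle ≡ W
      w′ = proj₂ (proj₂ (proj₂ (halve (whole h))))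
    whole∘halve : ∀ s → proj₁ (whole (halve s)) ≡ proj₁ s
    whole∘halve (S , _ , symmetric) = sym (Decomposition.decomposes (symmetric-split S symmetric))

-- From now on K = 2k + 1 is odd.  Then width and rise of every step, hence of
-- every path, have the same parity.
module OddWidth (k : ℕ) where
  K : ℕ
  K = 2 * k + 1

  open Paths K

  -- half the difference between the width and the rise of a step
  stepSurplus : Step K → ℕ
  stepSurplus up = k
  stepSurplus down = suc k
  stepSurplus (hor ℓ _ _) = ℓ

  surplus : Path → ℕ
  surplus [] = 0
  surplus (x ∷ p) = stepSurplus x + surplus p

  width-rise-step : (x : Step K) → + width2 x ≡ rise x ℤ.+ + (stepSurplus x * 2)
  width-rise-step up = trans (cong +_ (odd k)) (ℤP.pos-+ 1 (k * 2))
    where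
    odd : ∀ n → 2 * n + 1 ≡ 1 + n * 2
    odd = ℕ-Ring.solve-∀
  width-rise-step down = cong +_ (odd k)
    where
    odd : ∀ n → 2 * n + 1 ≡ suc (n * 2)
    odd = ℕ-Ring.solve-∀
  width-rise-step (hor ℓ _ _) = cong +_ (ℕP.*-comm 2 ℓ)

  width-rise : (P : Path) → + width P ≡ R P ℤ.+ + (surplus P * 2)
  width-rise [] = refl
  width-rise (x ∷ P) = begin
      + (width2 x + width P)                                  ≡⟨ ℤP.pos-+ (width2 x) (width P) ⟩
      + width2 x ℤ.+ + width P                                ≡⟨ cong₂ ℤ._+_ (width-rise-step x) (width-rise P) ⟩
      (rise x ℤ.+ + (s * 2)) ℤ.+ (R P ℤ.+ + (surplus P * 2))   ≡⟨ regroup (rise x) (+ (s * 2)) (R P) _ ⟩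
      (rise x ℤ.+ R P) ℤ.+ (+ (s * 2) ℤ.+ + (surplus P * 2))   ≡⟨ cong (λ z → rise x ℤ.+ R P ℤ.+ z) (ℤP.pos-+ (s * 2) _) ⟨
      (rise x ℤ.+ R P) ℤ.+ + (s * 2 + surplus P * 2)           ≡⟨ cong (λ z → rise x ℤ.+ R P ℤ.+ + z) (ℕP.*-distribʳ-+ 2 s _) ⟨
      R (x ∷ P) ℤ.+ + (surplus (x ∷ P) * 2) ∎
    where
    open ≡-Reasoning
    s : ℕ
    s = stepSurplus x
    regroup : ∀ a b c d → (a ℤ.+ b) ℤ.+ (c ℤ.+ d) ≡ (a ℤ.+ c) ℤ.+ (b ℤ.+ d)
    regroup = ℤ-Ring.solve-∀

  open Unlifting K using (height; +height)

  height-parity : (M : ℕ) (H : Path) (l : ℕ) → NB 0ℤ H → width H + l ≡ 2 * M → height H % 2 ≡ l % 2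
  height-parity M H l nb w = begin
      height H % 2                          ≡⟨ [m+kn]%n≡m%n (height H) (surplus H) 2 ⟨
      (height H + surplus H * 2) % 2        ≡⟨ parity-transfer (height H + surplus H * 2) l M width-even ⟩
      l % 2 ∎
    where
    open ≡-Reasoning
    width≡ : width H ≡ height H + surplus H * 2
    width≡ = ℤP.+-injective (trans (width-rise H)
               (trans (cong (ℤ._+ + (surplus H * 2)) (sym (+height H nb))) (sym (ℤP.pos-+ (height H) _))))
    width-even : height H + surplus H * 2 + l ≡ M * 2
    width-even = trans (cong (_+ l) (sym width≡)) (trans w (ℕP.*-comm 2 M))

module Lowering (k : ℕ) where
  open OddWidth k using (K; height-parity)
  open Paths K
  open Lifting K
  open Unlifting K
  open Symmetric K (ℕP.m≤n+m 1 (2 * k))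

  IsLowered : ℕ → Path × ℕ → Set
  IsLowered W (P , l) = l < K × R P ≡ ℤ.- + (l % 2) × width P + l ≡ W

  Lowered : ℕ → Set
  Lowered W = Σ (Path × ℕ) (IsLowered W)

  lowered-irrelevant : (W : ℕ) (Pl : Path × ℕ) → Irrelevant (IsLowered W Pl)
  lowered-irrelevant W (P , l) (a , b , c) (a′ , b′ , c′) =
    cong₂ _,_ (ℕP.<-irrelevant a a′) (cong₂ _,_ (uip b b′) (uip c c′))

  halves-lowered : (M : ℕ) → Halves (2 * M) ↔ Lowered (2 * M)
  halves-lowered M = mk↔-Σ (halves-irrelevant (2 * M)) (lowered-irrelevant (2 * M)) lower raise
      (λ ((P , l) , _ , rP , _) → cong (_, l) (unlift-lift P (m%n<n l 2) rP))
      (λ ((H , l) , _ , nb , _) → cong (_, l) (lift-unlift H nb))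
    where
    lower : Halves (2 * M) → Lowered (2 * M)
    lower ((H , l) , l<K , nb , w) =
      (unlift H , l) , l<K ,
      trans (rise-unlift H nb) (cong (λ e → ℤ.- + e) (height-parity M H l nb w)) ,
      trans (cong (_+ l) (width-unlift H)) w
    raise : Lowered (2 * M) → Halves (2 * M)
    raise ((P , l) , l<K , _ , w) = (lift 0 P , l) , l<K , nb-lift 0 0 P z≤n , trans (cong (_+ l) (width-lift 0 P)) w

data Middle (k : ℕ) : ℕ → Set where
  inner : {i : ℕ} → i < k → Middle k (i * 2)
  top   : Middle k (k * 2)
  odd   : {i : ℕ} → i < k → Middle k (suc (i * 2))

middle-suc : {k l : ℕ} → Middle k l → Middle (suc k) (suc (suc l))
middle-suc (inner i<k) = inner (s≤s i<k)
middle-suc top = top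
middle-suc (odd i<k) = odd (s≤s i<k)

middle : (k l : ℕ) → l ≤ k * 2 → Middle k l
middle zero zero _ = top
middle (suc k) zero _ = inner (s≤s z≤n)
middle (suc k) (suc zero) _ = odd (s≤s z≤n)
middle (suc k) (suc (suc l)) (s≤s (s≤s l≤2k)) = middle-suc (middle k l l≤2k)

middle-inner : (k i : ℕ) (b : i * 2 ≤ k * 2) (i<k : i < k) → middle k (i * 2) b ≡ inner i<k
middle-inner (suc k) zero _ (s≤s z≤n) = refl
middle-inner (suc k) (suc i) (s≤s (s≤s b)) (s≤s i<k) = cong middle-suc (middle-inner k i b i<k)

middle-top : (k : ℕ) (b : k * 2 ≤ k * 2) → middle k (k * 2) b ≡ top
middle-top zero _ = refl
middle-top (suc k) (s≤s (s≤s b)) = cong middle-suc (middle-top k b)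

middle-odd : (k i : ℕ) (b : suc (i * 2) ≤ k * 2) (i<k : i < k) → middle k (suc (i * 2)) b ≡ odd i<k
middle-odd (suc k) zero _ (s≤s z≤n) = refl
middle-odd (suc k) (suc i) (s≤s (s≤s b)) (s≤s i<k) = cong middle-suc (middle-odd k i b i<k)

data Band (k : ℕ) : ℕ → Set where
  low  : {i : ℕ} → i < k → Band k (suc i)
  high : (i : ℕ) → Band k (suc (k + i))

band-suc : {k ℓ : ℕ} → Band k ℓ → Band (suc k) (suc ℓ)
band-suc (low i<k) = low (s≤s i<k)
band-suc (high i) = high i

band : (k j : ℕ) → Band k (suc j)
band zero j = high j
band (suc k) zero = low (s≤s z≤n)
band (suc k) (suc j) = band-suc (band k j)

band-low : (k i : ℕ) (i<k : i < k) → band k i ≡ low i<k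
band-low (suc k) zero (s≤s z≤n) = refl
band-low (suc k) (suc i) (s≤s i<k) = cong band-suc (band-low k i i<k)

band-high : (k i : ℕ) → band k (k + i) ≡ high i
band-high zero i = refl
band-high (suc k) i = cong band-suc (band-high k i)

-- An even
-- middle width l = 2i < 2k with P not starting upwards gives an element of the
-- first part of Q' directly; otherwise one step is put in front of P (in place
-- of its first step if that is an up step), producing a path of width 2m + 1
-- ending at height -1:
--   l = 2i < 2k and P = up · P′   ↦  hor (k + 1 + i) · P′
--   l = 2k                         ↦  down · P
--   l = 2i + 1                     ↦  hor (i + 1) · P
-- The first step of such a path tells which case it came from.
module Folding (k m : ℕ) where
  open OddWidth k using (K)
  open Paths K
  open Lowering k using (Lowered; lowered-irrelevant)

  odd-K : suc (k * 2) ≡ 2 * k + 1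
  odd-K = identity k
    where
    identity : ∀ n → suc (n * 2) ≡ 2 * n + 1
    identity = ℕ-Ring.solve-∀

  below-K : {l : ℕ} → l ≤ k * 2 → l < K
  below-K {l} l≤2k = subst (l <_) odd-K (s≤s l≤2k)

  at-most-2k : {l : ℕ} → l < K → l ≤ k * 2
  at-most-2k {l} l<K = ℕP.≤-pred (subst (l <_) (sym odd-K) l<K)

  inner-fits : {i : ℕ} → i < k → i * 2 ≤ k * 2
  inner-fits i<k = ℕP.*-monoˡ-≤ 2 (ℕP.<⇒≤ i<k)

  odd-fits : {i : ℕ} → i < k → suc (i * 2) ≤ k * 2
  odd-fits {i} i<k = ℕP.≤-trans (ℕP.n≤1+n (suc (i * 2))) (ℕP.*-monoˡ-≤ 2 i<k)

  k+k : k + k ≡ k * 2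
  k+k = identity k
    where
    identity : ∀ n → n + n ≡ n * 2
    identity = ℕ-Ring.solve-∀

  low-fits : {i : ℕ} → i < k → suc i < K
  low-fits i<k = below-K (ℕP.≤-trans i<k (subst (k ≤_) k+k (ℕP.m≤m+n k k)))

  high-fits : {i : ℕ} → i < k → suc (k + i) < K
  high-fits {i} i<k = below-K (subst₂ _≤_ (ℕP.+-suc k i) k+k (ℕP.+-monoʳ-≤ k i<k))

  high-bound : {i : ℕ} → suc (k + i) < K → i < k
  high-bound {i} ℓ<K = ℕP.+-cancelˡ-≤ k (suc i) k (subst₂ _≤_ (sym (ℕP.+-suc k i)) (sym k+k) (at-most-2k ℓ<K))

  inner-up-width : (P : Path) (i : ℕ) → 2 * suc (k + i) + width P ≡ width (up ∷ P) + i * 2 + 1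
  inner-up-width P i = identity k i (width P)
    where
    identity : ∀ n j w → 2 * suc (n + j) + w ≡ (2 * n + 1 + w) + j * 2 + 1
    identity = ℕ-Ring.solve-∀

  top-width : (P : Path) → K + width P ≡ width P + k * 2 + 1
  top-width P = identity k (width P)
    where
    identity : ∀ n w → 2 * n + 1 + w ≡ w + n * 2 + 1
    identity = ℕ-Ring.solve-∀

  odd-width : (P : Path) (i : ℕ) → 2 * suc i + width P ≡ width P + suc (i * 2) + 1
  odd-width P i = identity i (width P)
    where
    identity : ∀ j w → 2 * suc j + w ≡ w + suc (j * 2) + 1
    identity = ℕ-Ring.solve-∀

  -- moving between the width conditions width P + l = 2m of Lowered and
  -- w + width P = 2m + 1 of the second part of Q', when w and l differ by one
  one-more : {a b n : ℕ} → b ≡ a + 1 → a ≡ n → b ≡ n + 1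
  one-more b≡a+1 a≡n = trans b≡a+1 (cong (_+ 1) a≡n)

  one-less : {a b n : ℕ} → b ≡ a + 1 → b ≡ n + 1 → a ≡ n
  one-less b≡a+1 b≡n+1 = ℕP.+-cancelʳ-≡ 1 _ _ (trans (sym b≡a+1) b≡n+1)

  even-rise : (i : ℕ) → ℤ.- + ((i * 2) % 2) ≡ 0ℤ
  even-rise i = cong (λ e → ℤ.- + e) (m*n%n≡0 i 2)

  odd-rise : (i : ℕ) → ℤ.- + (suc (i * 2) % 2) ≡ -[1+ 0 ]
  odd-rise i = cong (λ e → ℤ.- + e) ([m+kn]%n≡m%n 1 i 2)

  up-then : (x : ℤ) → + 1 ℤ.+ x ≡ 0ℤ → x ≡ -[1+ 0 ]
  up-then x e = trans (isolate x) (cong (λ z → -[1+ 0 ] ℤ.+ z) e)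
    where
    isolate : ∀ y → y ≡ -[1+ 0 ] ℤ.+ (+ 1 ℤ.+ y)
    isolate = ℤ-Ring.solve-∀

  down-then : (x : ℤ) → -[1+ 0 ] ℤ.+ x ≡ -[1+ 0 ] → x ≡ 0ℤ
  down-then x e = trans (isolate x) (cong (λ z → + 1 ℤ.+ z) e)
    where
    isolate : ∀ y → y ≡ + 1 ℤ.+ (-[1+ 0 ] ℤ.+ y)
    isolate = ℤ-Ring.solve-∀

  offset-width : (P : Path) (i : ℕ) → totalWidth2 P ≡ + (2 * m) ℤ.- + (2 * i) → width P + i * 2 ≡ 2 * m
  offset-width P i w = ℤP.+-injective (begin
      + (width P + i * 2)                  ≡⟨ cong (λ z → + (width P + z)) (ℕP.*-comm i 2) ⟩
      + (width P + 2 * i)                  ≡⟨ ℤP.pos-+ (width P) (2 * i) ⟩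
      + width P ℤ.+ + (2 * i)              ≡⟨ cong (ℤ._+ + (2 * i)) (trans (sym (totalWidth2≡width P)) w) ⟩
      + (2 * m) ℤ.- + (2 * i) ℤ.+ + (2 * i) ≡⟨ cancel (+ (2 * m)) (+ (2 * i)) ⟩
      + (2 * m) ∎)
    where
    open ≡-Reasoning
    cancel : ∀ a b → a ℤ.- b ℤ.+ b ≡ a
    cancel = ℤ-Ring.solve-∀

  width-offset : (P : Path) (i : ℕ) → width P + i * 2 ≡ 2 * m → totalWidth2 P ≡ + (2 * m) ℤ.- + (2 * i)
  width-offset P i w = begin
      totalWidth2 P                         ≡⟨ totalWidth2≡width P ⟩
      + width P                             ≡⟨ cancel (+ width P) (+ (2 * i)) ⟩
      + width P ℤ.+ + (2 * i) ℤ.- + (2 * i) ≡⟨ cong (ℤ._- + (2 * i)) (ℤP.pos-+ (width P) (2 * i)) ⟨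
      + (width P + 2 * i) ℤ.- + (2 * i)     ≡⟨ cong (λ z → + (width P + z) ℤ.- + (2 * i)) (ℕP.*-comm 2 i) ⟩
      + (width P + i * 2) ℤ.- + (2 * i)     ≡⟨ cong (λ z → + z ℤ.- + (2 * i)) w ⟩
      + (2 * m) ℤ.- + (2 * i) ∎
    where
    open ≡-Reasoning
    cancel : ∀ a b → a ≡ a ℤ.+ b ℤ.- b
    cancel = ℤ-Ring.solve-∀

  first-irrelevant : (P : Path) → Irrelevant (FirstNotUp P)
  first-irrelevant [] tt tt = refl
  first-irrelevant (down ∷ _) tt tt = refl
  first-irrelevant (hor _ _ _ ∷ _) tt tt = refl

  offset-unique : (P : Path) {i i′ : ℕ} → totalWidth2 P ≡ + (2 * m) ℤ.- + (2 * i) →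
    totalWidth2 P ≡ + (2 * m) ℤ.- + (2 * i′) → i ≡ i′
  offset-unique P {i} {i′} w w′ = ℕP.*-cancelʳ-≡ i i′ 2
    (ℕP.+-cancelˡ-≡ (width P) _ _ (trans (offset-width P i w) (sym (offset-width P i′ w′))))

  0≢-1 : 0ℤ ≢ -[1+ 0 ]
  0≢-1 ()

  -- The two parts of Q' are told apart by the final height, and the index i
  -- of the first part by the width.
  q-irrelevant : (P : Path) → Irrelevant (IsQ' m k P)
  q-irrelevant P (inj₁ (i , a , (b , c) , d)) (inj₁ (i′ , a′ , (b′ , c′) , d′)) with offset-unique P {i} {i′} b b′
  ... | refl = cong (λ z → inj₁ (i , z))
                 (cong₂ _,_ (ℕP.<-irrelevant a a′)
                   (cong₂ _,_ (cong₂ _,_ (uip b b′) (uip c c′)) (first-irrelevant P d d′)))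
  q-irrelevant P (inj₁ (_ , _ , (_ , c) , _)) (inj₂ ((_ , c′) , _)) = ⊥-elim (0≢-1 (trans (sym c) c′))
  q-irrelevant P (inj₂ ((_ , c) , _)) (inj₁ (_ , _ , (_ , c′) , _)) = ⊥-elim (0≢-1 (trans (sym c′) c))
  q-irrelevant P (inj₂ ((b , c) , d)) (inj₂ ((b′ , c′) , d′)) =
    cong inj₂ (cong₂ _,_ (cong₂ _,_ (uip b b′) (uip c c′)) (first-irrelevant P d d′))

  first-part : (P : Path) → FirstNotUp P → {i : ℕ} → i < k → R P ≡ ℤ.- + ((i * 2) % 2) → width P + i * 2 ≡ 2 * m → Q' m k
  first-part P f {i} i<k r w = P , inj₁ (i , i<k , (width-offset P i w , trans r (even-rise i)) , f)

  second-part : (x : Step K) (P : Path) → FirstNotUp (x ∷ P) →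
    width2 x + width P ≡ 2 * m + 1 → rise x ℤ.+ R P ≡ -[1+ 0 ] → Q' m k
  second-part x P f w r = x ∷ P , inj₂ ((trans (totalWidth2≡width (x ∷ P)) (cong +_ w) , r) , f)

  fold-with : {l : ℕ} → Middle k l → (P : Path) → R P ≡ ℤ.- + (l % 2) → width P + l ≡ 2 * m → Q' m k
  fold-with (inner {i} i<k) (up ∷ P) r w =
    second-part (hor (suc (k + i)) (s≤s z≤n) (high-fits i<k)) P tt (one-more (inner-up-width P i) w)
      (trans (ℤP.+-identityˡ (R P)) (up-then (R P) (trans r (even-rise i))))
  fold-with (inner i<k) [] r w = first-part [] tt i<k r w
  fold-with (inner i<k) (down ∷ P) r w = first-part (down ∷ P) tt i<k r w
  fold-with (inner i<k) (hor ℓ a b ∷ P) r w = first-part (hor ℓ a b ∷ P) tt i<k r w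
  fold-with top P r w =
    second-part down P tt (one-more (top-width P) w) (cong (λ z → -[1+ 0 ] ℤ.+ z) (trans r (even-rise k)))
  fold-with (odd {i} i<k) P r w =
    second-part (hor (suc i) (s≤s z≤n) (low-fits i<k)) P tt (one-more (odd-width P i) w)
      (trans (ℤP.+-identityˡ (R P)) (trans r (odd-rise i)))

  fold : Lowered (2 * m) → Q' m k
  fold ((P , l) , l<K , r , w) = fold-with (middle k l (at-most-2k l<K)) P r w

  unfold-band : {ℓ : ℕ} → Band k ℓ → ℓ < K → (P : Path) →
    2 * ℓ + width P ≡ 2 * m + 1 → R P ≡ -[1+ 0 ] → Lowered (2 * m)
  unfold-band (low {i} i<k) _ P w r =
    (P , suc (i * 2)) , below-K (odd-fits i<k) , trans r (sym (odd-rise i)) , one-less (odd-width P i) w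
  unfold-band (high i) ℓ<K P w r =
    (up ∷ P , i * 2) , below-K (inner-fits (high-bound ℓ<K)) ,
    trans (cong (λ z → + 1 ℤ.+ z) r) (sym (even-rise i)) , one-less (inner-up-width P i) w

  unfold : Q' m k → Lowered (2 * m)
  unfold (P , inj₁ (i , i<k , (w , r) , _)) =
    (P , i * 2) , below-K (inner-fits i<k) , trans r (sym (even-rise i)) , offset-width P i w
  unfold ([] , inj₂ ((_ , ()) , _))
  unfold (up ∷ _ , inj₂ (_ , ()))
  unfold (down ∷ P , inj₂ ((w , r) , _)) =
    (P , k * 2) , below-K ℕP.≤-refl , trans (down-then (R P) r) (sym (even-rise k)) ,
    one-less (top-width P) (ℤP.+-injective (trans (sym (totalWidth2≡width (down ∷ P))) w))
  unfold (hor (suc j) (s≤s z≤n) ℓ<K ∷ P , inj₂ ((w , r) , _)) =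
    unfold-band (band k j) ℓ<K P (ℤP.+-injective (trans (sym (totalWidth2≡width (hor (suc j) (s≤s z≤n) ℓ<K ∷ P))) w))
      (trans (sym (ℤP.+-identityˡ (R P))) r)

  -- Unfolding what was folded: the first step determines the case again.
  unfold∘fold-with : {l : ℕ} (v : Middle k l) (P : Path) (r : R P ≡ ℤ.- + (l % 2)) (w : width P + l ≡ 2 * m) →
    proj₁ (unfold (fold-with v P r w)) ≡ (P , l)
  unfold∘fold-with (inner {i} i<k) (up ∷ P) _ _ rewrite band-high k i = refl
  unfold∘fold-with (inner _) [] _ _ = refl
  unfold∘fold-with (inner _) (down ∷ _) _ _ = refl
  unfold∘fold-with (inner _) (hor _ _ _ ∷ _) _ _ = refl
  unfold∘fold-with top _ _ _ = refl
  unfold∘fold-with (odd {i} i<k) _ _ _ rewrite band-low k i i<k = refl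

  unfold∘fold : (u : Lowered (2 * m)) → proj₁ (unfold (fold u)) ≡ proj₁ u
  unfold∘fold ((P , l) , l<K , r , w) = unfold∘fold-with (middle k l (at-most-2k l<K)) P r w

  -- Folding what was unfolded: the middle width determines the case again.
  fold-inner : {i : ℕ} (i<k : i < k) (b : i * 2 ≤ k * 2) (P : Path) → FirstNotUp P →
    (r : R P ≡ ℤ.- + ((i * 2) % 2)) (w : width P + i * 2 ≡ 2 * m) →
    proj₁ (fold-with (middle k (i * 2) b) P r w) ≡ P
  fold-inner {i} i<k b P f r w rewrite middle-inner k i b i<k = level P f r w
    where
    level : (P : Path) → FirstNotUp P → (r : R P ≡ ℤ.- + ((i * 2) % 2)) (w : width P + i * 2 ≡ 2 * m) →
      proj₁ (fold-with (inner i<k) P r w) ≡ P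
    level [] _ _ _ = refl
    level (down ∷ _) _ _ _ = refl
    level (hor _ _ _ ∷ _) _ _ _ = refl

  fold-high : {i : ℕ} (i<k : i < k) (b : i * 2 ≤ k * 2) (P : Path)
    (r : R (up ∷ P) ≡ ℤ.- + ((i * 2) % 2)) (w : width (up ∷ P) + i * 2 ≡ 2 * m) →
    proj₁ (fold-with (middle k (i * 2) b) (up ∷ P) r w) ≡ hor (suc (k + i)) (s≤s z≤n) (high-fits i<k) ∷ P
  fold-high {i} i<k b _ _ _ rewrite middle-inner k i b i<k = refl

  fold-top : (b : k * 2 ≤ k * 2) (P : Path) (r : R P ≡ ℤ.- + ((k * 2) % 2)) (w : width P + k * 2 ≡ 2 * m) →
    proj₁ (fold-with (middle k (k * 2) b) P r w) ≡ down ∷ P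
  fold-top b _ _ _ rewrite middle-top k b = refl

  fold-odd : {i : ℕ} (i<k : i < k) (b : suc (i * 2) ≤ k * 2) (P : Path)
    (r : R P ≡ ℤ.- + (suc (i * 2) % 2)) (w : width P + suc (i * 2) ≡ 2 * m) →
    proj₁ (fold-with (middle k (suc (i * 2)) b) P r w) ≡ hor (suc i) (s≤s z≤n) (low-fits i<k) ∷ P
  fold-odd {i} i<k b _ _ _ rewrite middle-odd k i b i<k = refl

  fold∘unfold-band : {j : ℕ} (β : Band k (suc j)) (ℓ<K : suc j < K) (P : Path)
    (w : 2 * suc j + width P ≡ 2 * m + 1) (r : R P ≡ -[1+ 0 ]) →
    proj₁ (fold (unfold-band β ℓ<K P w r)) ≡ hor (suc j) (s≤s z≤n) ℓ<K ∷ P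
  fold∘unfold-band (low i<k) ℓ<K P _ _ =
    trans (fold-odd i<k _ P _ _) (cong (_∷ P) (hor-irrelevant (s≤s z≤n) (s≤s z≤n) _ ℓ<K))
  fold∘unfold-band (high _) ℓ<K P _ _ =
    trans (fold-high (high-bound ℓ<K) _ P _ _) (cong (_∷ P) (hor-irrelevant (s≤s z≤n) (s≤s z≤n) _ ℓ<K))

  fold∘unfold : (q : Q' m k) → proj₁ (fold (unfold q)) ≡ proj₁ q
  fold∘unfold (P , inj₁ (i , i<k , _ , f)) = fold-inner i<k _ P f _ _
  fold∘unfold ([] , inj₂ ((_ , ()) , _))
  fold∘unfold (up ∷ _ , inj₂ (_ , ()))
  fold∘unfold (down ∷ P , inj₂ _) = fold-top _ P _ _
  fold∘unfold (hor (suc j) (s≤s z≤n) ℓ<K ∷ P , inj₂ _) = fold∘unfold-band (band k j) ℓ<K P _ _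

  lowered-Q′ : Lowered (2 * m) ↔ Q' m k
  lowered-Q′ = mk↔-Σ (lowered-irrelevant (2 * m)) q-irrelevant fold unfold fold∘unfold unfold∘fold

theorem2p26 : (m k : ℕ) → 1 ≤ m →
    Q' m k ⤖ SD (2 * k + 1) (+ (4 * m))
theorem2p26 m k _ = ↔⇒⤖ (↔-sym (↔-trans symmetric (↔-trans (halves-lowered m) lowered-Q′)))
  where
  open Symmetric (2 * k + 1) (ℕP.m≤n+m 1 (2 * k)) using (Halves; symmetric-halves)
  open Lowering k using (halves-lowered)
  open Folding k m using (lowered-Q′)
  double-double : 2 * (2 * m) ≡ 4 * m
  double-double = sym (ℕP.*-assoc 2 2 m)
  symmetric : SD (2 * k + 1) (+ (4 * m)) ↔ Halves (2 * m)
  symmetric = subst (λ w → SD (2 * k + 1) (+ w) ↔ Halves (2 * m)) double-double (symmetric-halves (2 * m))
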